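{- Let $F\in NDF'$ and let $R\subseteq S_1\times S_2$ be a bisimulation on $F$-coalgebras $(S_1,f_1)$ and $(S_2,f_2)$, and let $g_1,g_2:R\to F(R)$ be two witness mappings for $R$. Define $g_1\sqcup_F g_2:R\to F(R)$ by structural induction on $F$: if $F=\mathbf{Id}$ or $F=\mathbf{B}$, $g_1\sqcup_F g_2=g_1=g_2$; if $F=F_1\times F_2$ and $g_i=g_i^1\times g_i^2$, then $g_1\sqcup_F g_2=(g_1^1\sqcup_{F_1}g_2^1)\times(g_1^2\sqcup_{F_2}g_2^2)$; if $F=G^{\mathbf{A}}$, then $g_1\sqcup_F g_2=\lambda a.\big(g_1(a)\sqcup_G g_2(a)\big)$; if $F=\mathcal{P}_\omega(G)$, then $(g_1\sqcup_F g_2)(s_1,s_2)=g_1(s_1,s_2)\cup g_2(s_1,s_2)$. Then $g_1\sqcup_F g_2$ is well defined (in particular $g_1=g_2$ whenever $F=\mathbf{Id}$ or $F=\mathbf{B}$) and is again a witness mapping for the bisimulation $R$.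
   Context: $\mathbf{A}$ is a fixed set of actions. $NDF'$ is the class of functors on $\mathbf{Set}$ generated by the grammar $F::=\mathbf{Id}\mid \mathbf{B}\mid F\times F\mid F^{\mathbf{A}}\mid \mathcal{P}_\omega(F)$, where $\mathbf{Id}$ is the identity functor, $\mathbf{B}\neq\emptyset$ is a constant functor given by a join-semilattice with bottom (acting on maps as $id_{\mathbf{B}}$), $F_1\times F_2$ is the pointwise product, $G^{\mathbf{A}}(X)=G(X)^{\mathbf{A}}$ with $G^{\mathbf{A}}(f)(g)=G(f)\circ g$, and $\mathcal{P}_\omega(G)(X)$ is the set of finite subsets of $G(X)$ with $\mathcal{P}_\omega(G)(f)(S)=\{G(f)(x)\mid x\in S\}$. An $F$-coalgebra is a pair $(S,f)$ with $f:S\to F(S)$. A relation $R\subseteq S_1\times S_2$ is a bisimulation iff there is a map $g:R\to F(R)$ (a witness mapping) such that for the projections $\pi_i:R\to S_i$ one has $f_i\circ\pi_i=F(\pi_i)\circ g$ for $i=1,2$. For $F=F_1\times F_2$ a map $g:R\to F_1(R)\times F_2(R)$ is written $g^1\times g^2$ with components $g^j:R\to F_j(R)$; for $F=G^{\mathbf{A}}$, $g(a)$ denotes the map $r\mapsto g(r)(a)$. -}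

module Defs where

open import Level using (0ℓ)
open import Data.Product using (Σ; _×_; _,_; proj₁; proj₂)
open import Data.List using (List; map; _++_)
open import Data.List.Relation.Unary.All using (All)
open import Data.List.Relation.Unary.Any using (Any)
open import Relation.Binary.PropositionalEquality using (_≡_)
open import Relation.Binary.Lattice.Bundles using (BoundedJoinSemilattice)

-- Codes for the functor class NDF' over a fixed set of actions A.
-- B is a join-semilattice with bottom (hence nonempty).
data NDF (A : Set) : Set₁ where
  Id  : NDF A
  B   : BoundedJoinSemilattice 0ℓ 0ℓ 0ℓ → NDF A
  _⊗_ : NDF A → NDF A → NDF A
  _^A : NDF A → NDF A
  Pω  : NDF A → NDF A

-- Object part.  Finite subsets are represented by lists, compared
-- extensionally (see Eq below).
⟦_⟧ : {A : Set} → NDF A → Set → Set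
⟦ Id ⟧ X = X
⟦ B L ⟧ X = BoundedJoinSemilattice.Carrier L
⟦ F ⊗ G ⟧ X = ⟦ F ⟧ X × ⟦ G ⟧ X
⟦_⟧ {A} (G ^A) X = A → ⟦ G ⟧ X
⟦ Pω G ⟧ X = List (⟦ G ⟧ X)

fmap : {A : Set} (F : NDF A) {X Y : Set} → (X → Y) → ⟦ F ⟧ X → ⟦ F ⟧ Y
fmap Id f x = f x
fmap (B L) f x = x
fmap (F ⊗ G) f (x , y) = fmap F f x , fmap G f y
fmap (G ^A) f g = λ a → fmap G f (g a)
fmap (Pω G) f xs = map (fmap G f) xs

Eq : {A : Set} (F : NDF A) {X : Set} → ⟦ F ⟧ X → ⟦ F ⟧ X → Set
Eq Id x y = x ≡ y
Eq (B L) x y = x ≡ y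
Eq (F ⊗ G) (x₁ , x₂) (y₁ , y₂) = Eq F x₁ y₁ × Eq G x₂ y₂
Eq (G ^A) f g = ∀ a → Eq G (f a) (g a)
Eq (Pω G) xs ys =
  All (λ x → Any (λ y → Eq G x y) ys) xs × All (λ y → Any (λ x → Eq G x y) xs) ys

Carrier : {S₁ S₂ : Set} → (S₁ → S₂ → Set) → Set
Carrier {S₁} {S₂} R = Σ (S₁ × S₂) (λ p → R (proj₁ p) (proj₂ p))

π₁ : {S₁ S₂ : Set} {R : S₁ → S₂ → Set} → Carrier R → S₁
π₁ r = proj₁ (proj₁ r)

π₂ : {S₁ S₂ : Set} {R : S₁ → S₂ → Set} → Carrier R → S₂
π₂ r = proj₂ (proj₁ r)

-- R is a genuine relation (a subset of S₁ × S₂): membership is a proposition.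
IsRelation : {S₁ S₂ : Set} → (S₁ → S₂ → Set) → Set
IsRelation {S₁} {S₂} R = ∀ {s₁ : S₁} {s₂ : S₂} (p q : R s₁ s₂) → p ≡ q

IsWitness : {A : Set} (F : NDF A) {S₁ S₂ : Set}
  (f₁ : S₁ → ⟦ F ⟧ S₁) (f₂ : S₂ → ⟦ F ⟧ S₂)
  (R : S₁ → S₂ → Set) → (Carrier R → ⟦ F ⟧ (Carrier R)) → Set
IsWitness F f₁ f₂ R g =
  ∀ r → Eq F (f₁ (π₁ r)) (fmap F π₁ (g r)) × Eq F (f₂ (π₂ r)) (fmap F π₂ (g r))

join : {A : Set} (F : NDF A) {Y X : Set} → (Y → ⟦ F ⟧ X) → (Y → ⟦ F ⟧ X) → Y → ⟦ F ⟧ X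
join Id g₁ g₂ = g₁
join (B L) g₁ g₂ = g₁
join (F ⊗ G) g₁ g₂ r =
  join F (λ r' → proj₁ (g₁ r')) (λ r' → proj₁ (g₂ r')) r ,
  join G (λ r' → proj₂ (g₁ r')) (λ r' → proj₂ (g₂ r')) r
join (G ^A) g₁ g₂ r = λ a → join G (λ r' → g₁ r' a) (λ r' → g₂ r' a) r
join (Pω G) g₁ g₂ r = g₁ r ++ g₂ r

-- Well-definedness: at every Id / B node reached by the inductive
-- definition (through × and ^A, not inside Pω) the two mappings agree.
data ⊤ : Set where
  tt : ⊤

Agree : {A : Set} (F : NDF A) {X : Set} → ⟦ F ⟧ X → ⟦ F ⟧ X → Set
Agree Id x y = x ≡ y
Agree (B L) x y = x ≡ y
Agree (F ⊗ G) (x₁ , x₂) (y₁ , y₂) = Agree F x₁ y₁ × Agree G x₂ y₂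
Agree (G ^A) f g = ∀ a → Agree G (f a) (g a)
Agree (Pω G) xs ys = ⊤

module Submission where

-- Both halves of the theorem are proved by structural
-- induction on the functor code F, and each inductive step is an
-- instance of a small closure property of witness mappings:
--   * a witness for F ⊗ G splits into witnesses for F and G, and
--     witnesses for F and G pair up to a witness for F ⊗ G;
--   * likewise a witness for G ^A is an A-indexed family of witnesses
--     for G, and conversely;
--   * the pointwise union of two witnesses for Pω G is a witness, since
--     a finite set that equals both Y and Z as a set also equals Y ∪ Z.
-- Agreement at Id needs that R is a genuine relation: an element of the
-- carrier of R is determined by its two projections.  Agreement at B is
-- immediate, since B acts on maps as the identity.

open import Defs
open import Data.Product using (_×_; _,_; proj₁; proj₂)
open import Data.List using (List; _++_)
open import Data.List.Properties using (map-++)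
open import Data.List.Relation.Unary.All using (All)
import Data.List.Relation.Unary.All as All
open import Data.List.Relation.Unary.All.Properties using (++⁺)
open import Data.List.Relation.Unary.Any using (Any)
open import Data.List.Relation.Unary.Any.Properties using (++⁺ˡ)
open import Relation.Binary.PropositionalEquality
  using (_≡_; refl; sym; trans; cong; subst)

SameElements : {X : Set} → (X → X → Set) → List X → List X → Set
SameElements E xs ys =
  All (λ x → Any (λ y → E x y) ys) xs × All (λ y → Any (λ x → E x y) xs) ys

sameElements-++ : {X : Set} (E : X → X → Set) {xs ys zs : List X} →
  SameElements E xs ys → SameElements E xs zs → SameElements E xs (ys ++ zs)
sameElements-++ E (xs⊆ys , ys⊆xs) (_ , zs⊆xs) =
  All.map ++⁺ˡ xs⊆ys , ++⁺ ys⊆xs zs⊆xs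

carrier-≡ : {S₁ S₂ : Set} {R : S₁ → S₂ → Set} → IsRelation R →
  (x y : Carrier R) → π₁ x ≡ π₁ y → π₂ x ≡ π₂ y → x ≡ y
carrier-≡ isR ((s₁ , s₂) , p) ((.s₁ , .s₂) , q) refl refl =
  cong (λ pq → (s₁ , s₂) , pq) (isR p q)

module _ {A : Set} {S₁ S₂ : Set} {R : S₁ → S₂ → Set} where

  witness-fst : (F G : NDF A) {f₁ : S₁ → ⟦ F ⊗ G ⟧ S₁} {f₂ : S₂ → ⟦ F ⊗ G ⟧ S₂}
    {g : Carrier R → ⟦ F ⊗ G ⟧ (Carrier R)} →
    IsWitness (F ⊗ G) f₁ f₂ R g →
    IsWitness F (λ s → proj₁ (f₁ s)) (λ s → proj₁ (f₂ s)) R (λ r → proj₁ (g r))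
  witness-fst F G w r = proj₁ (proj₁ (w r)) , proj₁ (proj₂ (w r))

  witness-snd : (F G : NDF A) {f₁ : S₁ → ⟦ F ⊗ G ⟧ S₁} {f₂ : S₂ → ⟦ F ⊗ G ⟧ S₂}
    {g : Carrier R → ⟦ F ⊗ G ⟧ (Carrier R)} →
    IsWitness (F ⊗ G) f₁ f₂ R g →
    IsWitness G (λ s → proj₂ (f₁ s)) (λ s → proj₂ (f₂ s)) R (λ r → proj₂ (g r))
  witness-snd F G w r = proj₂ (proj₁ (w r)) , proj₂ (proj₂ (w r))

  witness-pair : (F G : NDF A) {f₁ : S₁ → ⟦ F ⊗ G ⟧ S₁} {f₂ : S₂ → ⟦ F ⊗ G ⟧ S₂}
    {h : Carrier R → ⟦ F ⟧ (Carrier R)} {k : Carrier R → ⟦ G ⟧ (Carrier R)} →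
    IsWitness F (λ s → proj₁ (f₁ s)) (λ s → proj₁ (f₂ s)) R h →
    IsWitness G (λ s → proj₂ (f₁ s)) (λ s → proj₂ (f₂ s)) R k →
    IsWitness (F ⊗ G) f₁ f₂ R (λ r → h r , k r)
  witness-pair F G wh wk r = (proj₁ (wh r) , proj₁ (wk r)) , (proj₂ (wh r) , proj₂ (wk r))

  witness-at : (G : NDF A) {f₁ : S₁ → ⟦ G ^A ⟧ S₁} {f₂ : S₂ → ⟦ G ^A ⟧ S₂}
    {g : Carrier R → ⟦ G ^A ⟧ (Carrier R)} →
    IsWitness (G ^A) f₁ f₂ R g →
    (a : A) → IsWitness G (λ s → f₁ s a) (λ s → f₂ s a) R (λ r → g r a)
  witness-at G w a r = proj₁ (w r) a , proj₂ (w r) a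

  witness-abstract : (G : NDF A) {f₁ : S₁ → ⟦ G ^A ⟧ S₁} {f₂ : S₂ → ⟦ G ^A ⟧ S₂}
    {g : Carrier R → ⟦ G ^A ⟧ (Carrier R)} →
    ((a : A) → IsWitness G (λ s → f₁ s a) (λ s → f₂ s a) R (λ r → g r a)) →
    IsWitness (G ^A) f₁ f₂ R g
  witness-abstract G w r = (λ a → proj₁ (w a r)) , (λ a → proj₂ (w a r))

  -- One side of the union step: if a finite set equals the images of both
  -- Y and Z under p, it equals the image of Y ∪ Z, because images of
  -- finite sets commute with unions.
  image-union : (G : NDF A) {S : Set} (p : Carrier R → S)
    {xs : ⟦ Pω G ⟧ S} {ys zs : ⟦ Pω G ⟧ (Carrier R)} →
    Eq (Pω G) xs (fmap (Pω G) p ys) → Eq (Pω G) xs (fmap (Pω G) p zs) →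
    Eq (Pω G) xs (fmap (Pω G) p (ys ++ zs))
  image-union G p {xs} {ys} {zs} eys ezs =
    subst (Eq (Pω G) xs) (sym (map-++ (fmap G p) ys zs))
      (sameElements-++ (Eq G) eys ezs)

  witness-union : (G : NDF A) {f₁ : S₁ → ⟦ Pω G ⟧ S₁} {f₂ : S₂ → ⟦ Pω G ⟧ S₂}
    {g₁ g₂ : Carrier R → ⟦ Pω G ⟧ (Carrier R)} →
    IsWitness (Pω G) f₁ f₂ R g₁ → IsWitness (Pω G) f₁ f₂ R g₂ →
    IsWitness (Pω G) f₁ f₂ R (λ r → g₁ r ++ g₂ r)
  witness-union G w₁ w₂ r =
    image-union G π₁ (proj₁ (w₁ r)) (proj₁ (w₂ r)) ,
    image-union G π₂ (proj₂ (w₁ r)) (proj₂ (w₂ r))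

  -- Well-definedness of g₁ ⊔_F g₂: two witnesses agree at every Id and B
  -- node, because there each is determined by f₁ and f₂.
  witnesses-agree : IsRelation R → (F : NDF A) {f₁ : S₁ → ⟦ F ⟧ S₁} {f₂ : S₂ → ⟦ F ⟧ S₂}
    {g₁ g₂ : Carrier R → ⟦ F ⟧ (Carrier R)} →
    IsWitness F f₁ f₂ R g₁ → IsWitness F f₁ f₂ R g₂ →
    ∀ r → Agree F (g₁ r) (g₂ r)
  witnesses-agree isR Id {g₁ = g₁} {g₂} w₁ w₂ r =
    carrier-≡ isR (g₁ r) (g₂ r)
      (trans (sym (proj₁ (w₁ r))) (proj₁ (w₂ r)))
      (trans (sym (proj₂ (w₁ r))) (proj₂ (w₂ r)))
  witnesses-agree isR (B L) w₁ w₂ r = trans (sym (proj₁ (w₁ r))) (proj₁ (w₂ r))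
  witnesses-agree isR (F ⊗ G) w₁ w₂ r =
    witnesses-agree isR F (witness-fst F G w₁) (witness-fst F G w₂) r ,
    witnesses-agree isR G (witness-snd F G w₁) (witness-snd F G w₂) r
  witnesses-agree isR (G ^A) w₁ w₂ r a =
    witnesses-agree isR G (witness-at G w₁ a) (witness-at G w₂ a) r
  witnesses-agree isR (Pω G) w₁ w₂ r = tt

  -- The join g₁ ⊔_F g₂ of two witnesses is again a witness.  (At Id and B
  -- the join is g₁, so no hypothesis on R is needed here.)
  join-witness : (F : NDF A) {f₁ : S₁ → ⟦ F ⟧ S₁} {f₂ : S₂ → ⟦ F ⟧ S₂}
    {g₁ g₂ : Carrier R → ⟦ F ⟧ (Carrier R)} →
    IsWitness F f₁ f₂ R g₁ → IsWitness F f₁ f₂ R g₂ →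
    IsWitness F f₁ f₂ R (join F g₁ g₂)
  join-witness Id w₁ w₂ = w₁
  join-witness (B L) w₁ w₂ = w₁
  join-witness (F ⊗ G) w₁ w₂ =
    witness-pair F G
      (join-witness F (witness-fst F G w₁) (witness-fst F G w₂))
      (join-witness G (witness-snd F G w₁) (witness-snd F G w₂))
  join-witness (G ^A) w₁ w₂ =
    witness-abstract G (λ a → join-witness G (witness-at G w₁ a) (witness-at G w₂ a))
  join-witness (Pω G) w₁ w₂ = witness-union G w₁ w₂

mainTheorem4 : {A : Set} (F : NDF A) {S₁ S₂ : Set}
    (f₁ : S₁ → ⟦ F ⟧ S₁) (f₂ : S₂ → ⟦ F ⟧ S₂)
    (R : S₁ → S₂ → Set) → IsRelation R →
    (g₁ g₂ : Carrier R → ⟦ F ⟧ (Carrier R)) →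
    IsWitness F f₁ f₂ R g₁ → IsWitness F f₁ f₂ R g₂ →
    (∀ r → Agree F (g₁ r) (g₂ r)) × IsWitness F f₁ f₂ R (join F g₁ g₂)
mainTheorem4 F f₁ f₂ R isR g₁ g₂ w₁ w₂ =
  witnesses-agree isR F w₁ w₂ , join-witness F w₁ w₂
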